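{- Let $a,b,D\in\mathbb{Z}$ with $D\ne1$ a fundamental discriminant, $b>0$, $4Da^3\ne27b$, $\gcd(a,b_3)=1$ where $b=b_1b_3^3$ with $b_1$ cubefree, $K=\mathbb{Q}(\sqrt D)$, $\tau$ its nontrivial automorphism. Let $v=v_1+v_2\sqrt D\in\mathbb{Z}_K$ be a primitive algebraic integer such that $v\tau(v)$ is divisible only by primes split in $K/\mathbb{Q}$, and let $p$ be any prime split in $K/\mathbb{Q}$. Then there exists $d_p\in\mathbb{Q}_p$ with $d_p^2=D$, and the cubic $$2v_2X^3+2Dv_1Y^3+\frac{2b}{v_1^2-Dv_2^2}Z^3+6v_1X^2Y+6v_2DXY^2+2a(X^2Z-DY^2Z)=0$$ has a nontrivial solution in $\mathbb{Q}_p$ if and only if the cubic $u_1X^3+u_2Y^3+u_3Z^3-cXYZ=0$ does, where $u_1=v_1+v_2d_p$, $u_2=v_1-v_2d_p$, $u_3=\frac{2b}{v\tau(v)}d_p$ and $c=2ad_p$.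
   Context: An algebraic integer $v\in\mathbb{Z}_K$ is primitive if $v/n\in\mathbb{Z}_K$ with $n\in\mathbb{Z}$ implies $n=\pm1$. -}

module Defs where

open import Data.Nat as ℕ using (ℕ; suc; _^_)
open import Data.Nat.Primality using (Prime)
open import Data.Integer as ℤ using (ℤ; +_; _-_; -_; 0ℤ; 1ℤ)
open import Data.Integer.Divisibility using (_∣_)
open import Data.Integer.DivMod using (_%ℕ_; _/_)
open import Data.Product using (Σ; ∃; ∃-syntax; _×_; _,_)
open import Data.Sum using (_⊎_)
open import Relation.Binary.PropositionalEquality
open import Relation.Nullary using (¬_)
open import Data.Integer.Solver using (module +-*-Solver)
open +-*-Solver

_∣ᶻ_ : ℤ → ℤ → Set
d ∣ᶻ m = Σ ℤ λ q → m ≡ q ℤ.* d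

SquareFree : ℤ → Set
SquareFree m = ∀ q → Prime q → ¬ (+ (q ^ 2) ∣ m)

CubeFree : ℤ → Set
CubeFree m = ∀ q → Prime q → ¬ (+ (q ^ 3) ∣ m)

FundamentalDiscriminant : ℤ → Set
FundamentalDiscriminant D =
  (D %ℕ 4 ≡ 1 × SquareFree D)
  ⊎ (Σ ℤ λ m → D ≡ + 4 ℤ.* m × (m %ℕ 4 ≡ 2 ⊎ m %ℕ 4 ≡ 3) × SquareFree m)

-- The quadratic field K = ℚ(√D).  An element of K of the form
-- v₁ + v₂√D with 2v₁ = x, 2v₂ = y is encoded by the integer pair (x , y).
-- It lies in ℤ_K = ℤ[(D + √D)/2] iff x ≡ y·D (mod 2).

InOK : ℤ → ℤ → ℤ → Set
InOK D x y = + 2 ∣ (x - y ℤ.* D)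

Primitive : ℤ → ℤ → ℤ → Set
Primitive D x y = ∀ (n x′ y′ : ℤ) → x ≡ n ℤ.* x′ → y ≡ n ℤ.* y′ →
  InOK D x′ y′ → (n ≡ 1ℤ ⊎ n ≡ - 1ℤ)

normK : ℤ → ℤ → ℤ → ℤ
normK D x y = (x ℤ.* x - D ℤ.* (y ℤ.* y)) / (+ 4)

-- a rational prime q splits in K/ℚ, K = ℚ(√D), D a fundamental
-- discriminant: q ∤ D and D is a square modulo 4q (Kronecker symbol (D/q) = 1)
SplitIn : ℤ → ℕ → Set
SplitIn D q = ¬ (+ q ∣ D) × ∃[ t ] (+ (4 ℕ.* q) ∣ (t ℤ.* t - D))

-- p-adic integers as the inverse limit lim ℤ/p^k: sequences (x_k) with
-- x_{k+1} ≡ x_k (mod p^k); two such sequences are equal iff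
-- x_k ≡ y_k (mod p^k) for all k.

pw : ℕ → ℕ → ℤ
pw p k = + (p ^ k)

record ℤₚ (p : ℕ) : Set where
  constructor mkℤₚ
  field
    seq : ℕ → ℤ
    coh : ∀ k → pw p k ∣ᶻ (seq (suc k) - seq k)
open ℤₚ public

module _ {p : ℕ} where

  infix 4 _≈ᶻ_
  _≈ᶻ_ : ℤₚ p → ℤₚ p → Set
  x ≈ᶻ y = ∀ k → pw p k ∣ᶻ (seq x k - seq y k)

  ιᶻ : ℤ → ℤₚ p
  ιᶻ n = mkℤₚ (λ _ → n) (λ k → 0ℤ , lem n k)
    where
    lem : ∀ n k → n - n ≡ 0ℤ ℤ.* pw p k
    lem n k = solve 2 (λ n P → n :- n := con 0ℤ :* P) refl n (pw p k)

  infixl 6 _+ᶻ_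
  _+ᶻ_ : ℤₚ p → ℤₚ p → ℤₚ p
  x +ᶻ y = mkℤₚ (λ k → seq x k ℤ.+ seq y k) c
    where
    c : ∀ k → pw p k ∣ᶻ ((seq x (suc k) ℤ.+ seq y (suc k)) - (seq x k ℤ.+ seq y k))
    c k with coh x k | coh y k
    ... | (q₁ , e₁) | (q₂ , e₂) = q₁ ℤ.+ q₂ , (begin
          (x′ ℤ.+ y′) - (x₀ ℤ.+ y₀)       ≡⟨ solve 4 (λ a b c d → (a :+ b) :- (c :+ d) := (a :- c) :+ (b :- d)) refl x′ y′ x₀ y₀ ⟩
          (x′ - x₀) ℤ.+ (y′ - y₀)          ≡⟨ cong₂ ℤ._+_ e₁ e₂ ⟩
          q₁ ℤ.* P ℤ.+ q₂ ℤ.* P            ≡⟨ solve 3 (λ a b P → a :* P :+ b :* P := (a :+ b) :* P) refl q₁ q₂ P ⟩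
          (q₁ ℤ.+ q₂) ℤ.* P ∎)
      where
      open ≡-Reasoning
      x′ = seq x (suc k); y′ = seq y (suc k); x₀ = seq x k; y₀ = seq y k; P = pw p k

  infixl 7 _*ᶻ_
  _*ᶻ_ : ℤₚ p → ℤₚ p → ℤₚ p
  x *ᶻ y = mkℤₚ (λ k → seq x k ℤ.* seq y k) c
    where
    c : ∀ k → pw p k ∣ᶻ ((seq x (suc k) ℤ.* seq y (suc k)) - (seq x k ℤ.* seq y k))
    c k with coh x k | coh y k
    ... | (q₁ , e₁) | (q₂ , e₂) = q₁ ℤ.* y′ ℤ.+ x₀ ℤ.* q₂ , (begin
          x′ ℤ.* y′ - x₀ ℤ.* y₀                  ≡⟨ solve 4 (λ a b c d → a :* b :- c :* d := (a :- c) :* b :+ c :* (b :- d)) refl x′ y′ x₀ y₀ ⟩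
          (x′ - x₀) ℤ.* y′ ℤ.+ x₀ ℤ.* (y′ - y₀)   ≡⟨ cong₂ (λ u w → u ℤ.* y′ ℤ.+ x₀ ℤ.* w) e₁ e₂ ⟩
          q₁ ℤ.* P ℤ.* y′ ℤ.+ x₀ ℤ.* (q₂ ℤ.* P)   ≡⟨ solve 5 (λ a b c d P → a :* P :* b :+ c :* (d :* P) := (a :* b :+ c :* d) :* P) refl q₁ y′ x₀ q₂ P ⟩
          (q₁ ℤ.* y′ ℤ.+ x₀ ℤ.* q₂) ℤ.* P ∎)
      where
      open ≡-Reasoning
      x′ = seq x (suc k); y′ = seq y (suc k); x₀ = seq x k; y₀ = seq y k; P = pw p k

-- p-adic numbers ℚ_p = ℤ_p[1/p]: a pair (x , e) stands for x / p^e.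

record ℚₚ (p : ℕ) : Set where
  constructor _/p^_
  field
    num : ℤₚ p
    ex  : ℕ
open ℚₚ public

module _ {p : ℕ} where

  infix 4 _≈_
  _≈_ : ℚₚ p → ℚₚ p → Set
  (x /p^ e) ≈ (y /p^ f) = x *ᶻ ιᶻ (pw p f) ≈ᶻ y *ᶻ ιᶻ (pw p e)

  ι : ℤ → ℚₚ p
  ι n = ιᶻ n /p^ 0

  infixl 6 _+_ _-ₚ_
  _+_ : ℚₚ p → ℚₚ p → ℚₚ p
  (x /p^ e) + (y /p^ f) = (x *ᶻ ιᶻ (pw p f) +ᶻ y *ᶻ ιᶻ (pw p e)) /p^ (e ℕ.+ f)

  infixl 7 _*_
  _*_ : ℚₚ p → ℚₚ p → ℚₚ p
  (x /p^ e) * (y /p^ f) = (x *ᶻ y) /p^ (e ℕ.+ f)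

  -ₚ_ : ℚₚ p → ℚₚ p
  -ₚ x = ι (- 1ℤ) * x

  _-ₚ_ : ℚₚ p → ℚₚ p → ℚₚ p
  x -ₚ y = x + (-ₚ y)

  _³ : ℚₚ p → ℚₚ p
  x ³ = x * x * x

  _² : ℚₚ p → ℚₚ p
  x ² = x * x

HasNontrivialZero : (p : ℕ) → (ℚₚ p → ℚₚ p → ℚₚ p → ℚₚ p) → Set
HasNontrivialZero p F =
  Σ (ℚₚ p) λ X → Σ (ℚₚ p) λ Y → Σ (ℚₚ p) λ Z →
    ¬ (X ≈ ι 0ℤ × Y ≈ ι 0ℤ × Z ≈ ι 0ℤ) × F X Y Z ≈ ι 0ℤ

-- Splitting gives t with t² ≡ D (mod 4p), and p ∤ t because p ∤ D, so Newton's
-- iteration lifts t to a square root d of D in ℚ_p. With D written as d², the linear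
-- substitution (X, Y, Z) ↦ (X + dY, dY − X, Z) turns d times the first cubic into the
-- second by a polynomial identity. The substitution has determinant 2d, and 2 and D
-- (hence d) are non-zero-divisors in ℚ_p, so it matches nontrivial zeros in both directions.

module Submission where

open import Level using (0ℓ; _⊔_)
open import Data.Nat as ℕ using (ℕ; zero; suc; NonZero)
import Data.Nat.Properties as ℕ
open import Data.Nat.Coprimality using (Coprime; coprime-Bézout; prime⇒coprime)
open import Data.Nat.GCD using (module Bézout)
open import Data.Nat.Primality using (Prime; prime⇒irreducible; prime⇒nonZero; prime⇒nonTrivial)
open import Data.Nat.Tactic.RingSolver using () renaming (solve-∀ to ℕ-solve-∀)
open import Data.Integer as ℤ using (ℤ; +_; 0ℤ; 1ℤ; _>_) renaming (_*_ to _*ℤ_; _^_ to _^ℤ_)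
import Data.Integer.Properties as ℤ
open import Data.Integer.Divisibility using (_∣_)
import Data.Integer.Divisibility.Signed as Signed
open import Data.Integer.GCD using (gcd)
open import Data.Integer.Tactic.RingSolver using (solve-∀) renaming (solve to ℤ-solve)
open import Data.List using (_∷_; [])
open import Data.Maybe using (Maybe; just; nothing)
open import Data.Product using (Σ; _×_; _,_; proj₁; proj₂)
open import Data.Sum using (inj₁; inj₂)
open import Function using (_$_)
open import Function.Bundles using (_⇔_; mk⇔)
open import Relation.Nullary using (¬_; yes; no)
open import Data.Empty using (⊥-elim)
open import Algebra.Structures using (IsCommutativeMonoid)
open import Algebra.Structures.Biased using (isCommutativeMonoidˡ; IsCommutativeSemiringˡ)
open import Algebra.Solver.Ring.AlmostCommutativeRing
import Algebra.Solver.Ring as RingSolver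
import Relation.Binary.PropositionalEquality as ≡

-- Cubic forms over an abstract ring

-- α and δ play the roles of a and D. The operations are parameters so that the forms can
-- be instantiated both in a ring and in the syntax of the ring solver.
module CubicForms {a} {A : Set a} (add mul : A → A → A) (neg : A → A) (fromℤ : ℤ → A) where

  infixl 6 _+_ _-_
  infixl 7 _*_

  _+_ _*_ : A → A → A
  _+_ = add
  _*_ = mul

  _-_ : A → A → A
  x - y = x + neg y

  _² : A → A
  x ² = x * x

  _³ : A → A
  x ³ = x * x * x

  cubicForm : (α δ v₁ v₂ c₃ X Y Z : A) → A
  cubicForm α δ v₁ v₂ c₃ X Y Z =
    fromℤ (+ 2) * v₂ * X ³ + fromℤ (+ 2) * δ * v₁ * Y ³ + c₃ * Z ³
    + fromℤ (+ 6) * v₁ * X ² * Y + fromℤ (+ 6) * v₂ * δ * X * Y ²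
    + fromℤ (+ 2) * α * (X ² * Z - δ * Y ² * Z)

  hesseForm : (α d v₁ v₂ c₃ X Y Z : A) → A
  hesseForm α d v₁ v₂ c₃ X Y Z =
    (v₁ + v₂ * d) * X ³ + (v₁ - v₂ * d) * Y ³ + (c₃ * d) * Z ³
    - fromℤ (+ 2) * α * d * X * Y * Z

module CubicChangeOfVariables
  {c ℓ} (R : AlmostCommutativeRing c ℓ)
  (ℤ⟶R : ℤ.+-*-rawRing -Raw-AlmostCommutative⟶ R)
  where

  open AlmostCommutativeRing R
  open _-Raw-AlmostCommutative⟶_ ℤ⟶R renaming (⟦_⟧ to fromℤ)
  open import Relation.Binary.Reasoning.Setoid setoid

  fromℤ-≟ : ∀ m n → Maybe (fromℤ m ≈ fromℤ n)
  fromℤ-≟ m n with m ℤ.≟ n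
  ... | yes ≡.refl = just refl
  ... | no _ = nothing

  open RingSolver ℤ.+-*-rawRing R ℤ⟶R fromℤ-≟ using (solve; _:=_; con; _:+_; _:-_; _:*_; :-_)
  open CubicForms _+_ _*_ -_ fromℤ using (_-_; _³; cubicForm; hesseForm)
  module Syntax {n} = CubicForms (_:+_ {n}) _:*_ :-_ con

  HasNontrivialZero : (Carrier → Carrier → Carrier → Carrier) → Set (c ⊔ ℓ)
  HasNontrivialZero F =
    Σ Carrier λ X → Σ Carrier λ Y → Σ Carrier λ Z →
      ¬ (X ≈ 0# × Y ≈ 0# × Z ≈ 0#) × F X Y Z ≈ 0#

  NonZeroDivisor : Carrier → Set (c ⊔ ℓ)
  NonZeroDivisor a = ∀ x → a * x ≈ 0# → x ≈ 0#

  cubicForm-substitution : ∀ α d v₁ v₂ c₃ X Y Z →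
    d * cubicForm α (d * d) v₁ v₂ c₃ X Y Z
      ≈ hesseForm α d v₁ v₂ c₃ (X + d * Y) (d * Y - X) Z
  cubicForm-substitution = solve 8 (λ α d v₁ v₂ c₃ X Y Z →
    d :* Syntax.cubicForm α (d :* d) v₁ v₂ c₃ X Y Z
      := Syntax.hesseForm α d v₁ v₂ c₃ (X :+ d :* Y) (d :* Y Syntax.- X) Z) refl

  cubicForm-inverse-substitution : ∀ α d v₁ v₂ c₃ A B C →
    d * cubicForm α (d * d) v₁ v₂ c₃ (d * (A - B)) (A + B) (fromℤ (+ 2) * d * C)
      ≈ (fromℤ (+ 2) * d) ³ * hesseForm α d v₁ v₂ c₃ A B C
  cubicForm-inverse-substitution = solve 8 (λ α d v₁ v₂ c₃ A B C →
    d :* Syntax.cubicForm α (d :* d) v₁ v₂ c₃ (d :* (A Syntax.- B)) (A :+ B) (con (+ 2) :* d :* C)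
      := (con (+ 2) :* d) Syntax.³ :* Syntax.hesseForm α d v₁ v₂ c₃ A B C) refl

  ≈0-multiple : ∀ {x u} a → x ≈ a * u → u ≈ 0# → x ≈ 0#
  ≈0-multiple {x} {u} a x≈au u≈0 = begin
    x      ≈⟨ x≈au ⟩
    a * u  ≈⟨ *-cong refl u≈0 ⟩
    a * 0# ≈⟨ zeroʳ a ⟩
    0#     ∎

  ≈0-sum : ∀ {x u v} → x ≈ u + v → u ≈ 0# → v ≈ 0# → x ≈ 0#
  ≈0-sum {x} {u} {v} x≈u+v u≈0 v≈0 = begin
    x       ≈⟨ x≈u+v ⟩
    u + v   ≈⟨ +-cong u≈0 v≈0 ⟩
    0# + 0# ≈⟨ +-identityˡ 0# ⟩
    0#      ∎

  ≈0-difference : ∀ {x u v} → x ≈ u - v → u ≈ 0# → v ≈ 0# → x ≈ 0#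
  ≈0-difference x≈u-v u≈0 v≈0 = ≈0-sum x≈u-v u≈0 (trans (-‿cong v≈0) -0#≈0#)
    where
    -0#≈0# : - 0# ≈ 0#
    -0#≈0# = begin
      - 0#        ≈⟨ -‿cong (sym (zeroʳ 0#)) ⟩
      - (0# * 0#) ≈⟨ sym (-‿*-distribˡ 0# 0#) ⟩
      - 0# * 0#   ≈⟨ zeroʳ (- 0#) ⟩
      0#          ∎

  nonZeroDivisor-* : ∀ {a b} → NonZeroDivisor a → NonZeroDivisor b → NonZeroDivisor (a * b)
  nonZeroDivisor-* {a} {b} nzd-a nzd-b x abx≈0 =
    nzd-b x (nzd-a (b * x) (trans (sym (*-assoc a b x)) abx≈0))

  nonZeroDivisor-√ : ∀ {d δ} → d * d ≈ δ → NonZeroDivisor δ → NonZeroDivisor d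
  nonZeroDivisor-√ {d} {δ} d²≈δ nzd-δ x dx≈0 =
    nzd-δ x (≈0-multiple d (trans (*-cong (sym d²≈δ) refl) (*-assoc d d x)) dx≈0)

  cubicForm-cong-δ : ∀ {δ δ′} α v₁ v₂ c₃ X Y Z → δ ≈ δ′ →
    cubicForm α δ v₁ v₂ c₃ X Y Z ≈ cubicForm α δ′ v₁ v₂ c₃ X Y Z
  cubicForm-cong-δ _ _ _ _ _ _ _ δ≈δ′ =
    +-cong (+-cong (+-cong (+-cong (+-cong refl (*-cong (*-cong (*-cong refl δ≈δ′) refl) refl)) refl) refl)
                   (*-cong (*-cong (*-cong refl δ≈δ′) refl) refl))
           (*-cong refl (+-cong refl (-‿cong (*-cong (*-cong δ≈δ′ refl) refl))))

  module _ (α δ d : Carrier) (d²≈δ : d * d ≈ δ)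
           (nzd-2 : NonZeroDivisor (fromℤ (+ 2))) (nzd-δ : NonZeroDivisor δ)
           (v₁ v₂ c₃ : Carrier) where

    private
      nzd-d : NonZeroDivisor d
      nzd-d = nonZeroDivisor-√ d²≈δ nzd-δ

      nzd-2d : NonZeroDivisor (fromℤ (+ 2) * d)
      nzd-2d = nonZeroDivisor-* nzd-2 nzd-d

    cubic⇒hesse : HasNontrivialZero (cubicForm α δ v₁ v₂ c₃) →
                  HasNontrivialZero (hesseForm α d v₁ v₂ c₃)
    cubic⇒hesse (X , Y , Z , nontrivial , F≈0) = X + d * Y , d * Y - X , Z , nontrivial′ , G≈0
      where
      G≈0 : hesseForm α d v₁ v₂ c₃ (X + d * Y) (d * Y - X) Z ≈ 0#
      G≈0 = ≈0-multiple d (begin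
        hesseForm α d v₁ v₂ c₃ (X + d * Y) (d * Y - X) Z ≈⟨ cubicForm-substitution α d v₁ v₂ c₃ X Y Z ⟨
        d * cubicForm α (d * d) v₁ v₂ c₃ X Y Z          ≈⟨ *-cong refl (cubicForm-cong-δ α v₁ v₂ c₃ X Y Z d²≈δ) ⟩
        d * cubicForm α δ v₁ v₂ c₃ X Y Z                ∎) F≈0

      nontrivial′ : ¬ (X + d * Y ≈ 0# × d * Y - X ≈ 0# × Z ≈ 0#)
      nontrivial′ (L≈0 , M≈0 , Z≈0) = nontrivial (X≈0 , Y≈0 , Z≈0)
        where
        X≈0 : X ≈ 0#
        X≈0 = nzd-2 X (≈0-difference
          (solve 3 (λ X d Y → con (+ 2) :* X := (X :+ d :* Y) :- (d :* Y :- X)) refl X d Y) L≈0 M≈0)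
        Y≈0 : Y ≈ 0#
        Y≈0 = nzd-2d Y (≈0-sum
          (solve 3 (λ X d Y → con (+ 2) :* d :* Y := (X :+ d :* Y) :+ (d :* Y :- X)) refl X d Y) L≈0 M≈0)

    hesse⇒cubic : HasNontrivialZero (hesseForm α d v₁ v₂ c₃) →
                  HasNontrivialZero (cubicForm α δ v₁ v₂ c₃)
    hesse⇒cubic (A , B , C , nontrivial , G≈0) =
      d * (A - B) , A + B , fromℤ (+ 2) * d * C , nontrivial′ , F≈0
      where
      F≈0 : cubicForm α δ v₁ v₂ c₃ (d * (A - B)) (A + B) (fromℤ (+ 2) * d * C) ≈ 0#
      F≈0 = nzd-d _ (≈0-multiple ((fromℤ (+ 2) * d) ³) (begin
        d * cubicForm α δ v₁ v₂ c₃ (d * (A - B)) (A + B) (fromℤ (+ 2) * d * C)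
          ≈⟨ *-cong refl (cubicForm-cong-δ α v₁ v₂ c₃ _ _ _ d²≈δ) ⟨
        d * cubicForm α (d * d) v₁ v₂ c₃ (d * (A - B)) (A + B) (fromℤ (+ 2) * d * C)
          ≈⟨ cubicForm-inverse-substitution α d v₁ v₂ c₃ A B C ⟩
        (fromℤ (+ 2) * d) ³ * hesseForm α d v₁ v₂ c₃ A B C ∎) G≈0)

      nontrivial′ : ¬ (d * (A - B) ≈ 0# × A + B ≈ 0# × fromℤ (+ 2) * d * C ≈ 0#)
      nontrivial′ (X≈0 , Y≈0 , Z≈0) = nontrivial (A≈0 , B≈0 , nzd-2d C Z≈0)
        where
        A-B≈0 : A - B ≈ 0#
        A-B≈0 = nzd-d (A - B) X≈0
        A≈0 : A ≈ 0#
        A≈0 = nzd-2 A (≈0-sum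
          (solve 2 (λ A B → con (+ 2) :* A := (A :- B) :+ (A :+ B)) refl A B) A-B≈0 Y≈0)
        B≈0 : B ≈ 0#
        B≈0 = nzd-2 B (≈0-difference
          (solve 2 (λ A B → con (+ 2) :* B := (A :+ B) :- (A :- B)) refl A B) Y≈0 A-B≈0)

    cubicForm⇔hesseForm : HasNontrivialZero (cubicForm α δ v₁ v₂ c₃) ⇔
                          HasNontrivialZero (hesseForm α d v₁ v₂ c₃)
    cubicForm⇔hesseForm = mk⇔ cubic⇒hesse hesse⇒cubic

-- Divisibility by powers of p

open import Defs
open import Relation.Binary.PropositionalEquality
open ≡-Reasoning

pw-+ : ∀ p m n → pw p (m ℕ.+ n) ≡ pw p m ℤ.* pw p n
pw-+ p m n = trans (cong +_ (ℕ.^-distribˡ-+-* p m n)) (ℤ.pos-* (p ℕ.^ m) (p ℕ.^ n))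

pw-suc : ∀ p k → pw p (suc k) ≡ + p ℤ.* pw p k
pw-suc p k = ℤ.pos-* p (p ℕ.^ k)

≡⇒∣ᶻ-difference : ∀ {d a b} → a ≡ b → d ∣ᶻ (a ℤ.- b)
≡⇒∣ᶻ-difference {d} {a} refl = 0ℤ , trans (ℤ.+-inverseʳ a) (sym (ℤ.*-zeroˡ d))

∣ᶻ-linear : ∀ {d a u v} c₁ c₂ → a ≡ c₁ ℤ.* u ℤ.+ c₂ ℤ.* v → d ∣ᶻ u → d ∣ᶻ v → d ∣ᶻ a
∣ᶻ-linear {d} {a} {u} {v} c₁ c₂ a≡ (q₁ , u≡) (q₂ , v≡) = c₁ ℤ.* q₁ ℤ.+ c₂ ℤ.* q₂ , (begin
  a                                         ≡⟨ a≡ ⟩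
  c₁ ℤ.* u ℤ.+ c₂ ℤ.* v                     ≡⟨ cong₂ (λ s t → c₁ ℤ.* s ℤ.+ c₂ ℤ.* t) u≡ v≡ ⟩
  c₁ ℤ.* (q₁ ℤ.* d) ℤ.+ c₂ ℤ.* (q₂ ℤ.* d)   ≡⟨ regroup c₁ c₂ q₁ q₂ d ⟩
  (c₁ ℤ.* q₁ ℤ.+ c₂ ℤ.* q₂) ℤ.* d           ∎)
  where
  regroup : ∀ a b c e f → a ℤ.* (c ℤ.* f) ℤ.+ b ℤ.* (e ℤ.* f) ≡ (a ℤ.* c ℤ.+ b ℤ.* e) ℤ.* f
  regroup = solve-∀

∣ᶻ-multiple : ∀ {d a u} c → a ≡ c ℤ.* u → d ∣ᶻ u → d ∣ᶻ a
∣ᶻ-multiple {d} c a≡cu (q , u≡qd) = c ℤ.* q , trans a≡cu (trans (cong (c ℤ.*_) u≡qd) (sym (ℤ.*-assoc c q d)))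

*-distribˡ-difference : ∀ a b c → a ℤ.* b ℤ.- a ℤ.* c ≡ a ℤ.* (b ℤ.- c)
*-distribˡ-difference = solve-∀

coprime⇒bézout : ∀ {p n} → Coprime p ℤ.∣ n ∣ → Σ ℤ λ α → Σ ℤ λ β → α ℤ.* n ℤ.+ β ℤ.* + p ≡ 1ℤ
coprime⇒bézout {p} {n} coprime with natural (coprime-Bézout coprime) | ℤ.+∣i∣≡i⊎+∣i∣≡-i n
  where
  lift : ∀ x k y l → 1 ℕ.+ y ℕ.* l ≡ x ℕ.* k → + x ℤ.* + k ≡ 1ℤ ℤ.+ + y ℤ.* + l
  lift x k y l eq = sym (trans (cong (ℤ._+_ 1ℤ) (sym (ℤ.pos-* y l))) (trans (cong +_ eq) (ℤ.pos-* x k)))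
  cancel : ∀ a b → ℤ.- a ℤ.* b ℤ.+ (1ℤ ℤ.+ a ℤ.* b) ≡ 1ℤ
  cancel = solve-∀
  natural : ∀ {m} → Bézout.Identity 1 p m → Σ ℤ λ α → Σ ℤ λ β → α ℤ.* + m ℤ.+ β ℤ.* + p ≡ 1ℤ
  natural {m} (Bézout.+- x y eq) =
    ℤ.- + y , + x , trans (cong (ℤ._+_ (ℤ.- + y ℤ.* + m)) (lift x p y m eq)) (cancel (+ y) (+ m))
  natural {m} (Bézout.-+ x y eq) =
    + y , ℤ.- + x , trans (ℤ.+-comm (+ y ℤ.* + m) _) (trans (cong (ℤ._+_ (ℤ.- + x ℤ.* + p)) (lift y m x p eq)) (cancel (+ x) (+ p)))
... | α , β , eq | inj₁ |n|≡n  = α , β , subst (λ m → α ℤ.* m ℤ.+ β ℤ.* + p ≡ 1ℤ) |n|≡n eq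
... | α , β , eq | inj₂ |n|≡-n = ℤ.- α , β , trans (cong (ℤ._+ β ℤ.* + p) -α*n≡α*|n|) eq
  where
  -α*n≡α*|n| : ℤ.- α ℤ.* n ≡ α ℤ.* + ℤ.∣ n ∣
  -α*n≡α*|n| = trans (sym (ℤ.neg-distribˡ-* α n)) (trans (ℤ.neg-distribʳ-* α n) (cong (α ℤ.*_) (sym |n|≡-n)))

prime∤⇒coprime : ∀ {p n} → Prime p → ¬ (+ p ∣ n) → Coprime p ℤ.∣ n ∣
prime∤⇒coprime p-prime p∤n (d∣p , d∣n) with prime⇒irreducible p-prime d∣p
... | inj₁ d≡1 = d≡1
... | inj₂ refl = ⊥-elim (p∤n d∣n)

module _ {p : ℕ} where

  ∣ᶻ-pw-suc⇒∣ᶻ-pw : ∀ k {a} → pw p (suc k) ∣ᶻ a → pw p k ∣ᶻ a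
  ∣ᶻ-pw-suc⇒∣ᶻ-pw k (q , a≡) =
    q ℤ.* + p , trans a≡ (trans (cong (q ℤ.*_) (pw-suc p k)) (sym (ℤ.*-assoc q (+ p) (pw p k))))

  ∣ᶻ-pw⇒∣ᶻ-pw-suc : ∀ k {a} → pw p k ∣ᶻ a → pw p (suc k) ∣ᶻ (+ p ℤ.* a)
  ∣ᶻ-pw⇒∣ᶻ-pw-suc k {a} (q , a≡) = q , (begin
    + p ℤ.* a               ≡⟨ cong (+ p ℤ.*_) a≡ ⟩
    + p ℤ.* (q ℤ.* pw p k)  ≡⟨ ℤ.*-comm (+ p) _ ⟩
    q ℤ.* pw p k ℤ.* + p    ≡⟨ ℤ.*-assoc q (pw p k) (+ p) ⟩
    q ℤ.* (pw p k ℤ.* + p)  ≡⟨ cong (q ℤ.*_) (trans (ℤ.*-comm (pw p k) (+ p)) (sym (pw-suc p k))) ⟩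
    q ℤ.* pw p (suc k)      ∎)

  ∣ᶻ-cancelˡ-p : .{{_ : NonZero p}} → ∀ k {a} → pw p (suc k) ∣ᶻ (+ p ℤ.* a) → pw p k ∣ᶻ a
  ∣ᶻ-cancelˡ-p k {a} (q , pa≡) = q , ℤ.*-cancelˡ-≡ (+ p) a (q ℤ.* pw p k) (begin
    + p ℤ.* a               ≡⟨ pa≡ ⟩
    q ℤ.* pw p (suc k)      ≡⟨ cong (q ℤ.*_) (pw-suc p k) ⟩
    q ℤ.* (+ p ℤ.* pw p k)  ≡⟨ ℤ.*-comm q _ ⟩
    + p ℤ.* pw p k ℤ.* q    ≡⟨ ℤ.*-assoc (+ p) (pw p k) q ⟩
    + p ℤ.* (pw p k ℤ.* q)  ≡⟨ cong (+ p ℤ.*_) (ℤ.*-comm (pw p k) q) ⟩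
    + p ℤ.* (q ℤ.* pw p k)  ∎)

  ∣ᶻ-cancelˡ-coprime : ∀ {n} α β → α ℤ.* n ℤ.+ β ℤ.* + p ≡ 1ℤ →
                        ∀ k {a} → pw p k ∣ᶻ (n ℤ.* a) → pw p k ∣ᶻ a
  ∣ᶻ-cancelˡ-coprime α β bézout zero {a} _ = a , sym (ℤ.*-identityʳ a)
  ∣ᶻ-cancelˡ-coprime {n} α β bézout (suc k) {a} p^k+1∣na =
    ∣ᶻ-linear α β a≡ p^k+1∣na (∣ᶻ-pw⇒∣ᶻ-pw-suc k (∣ᶻ-cancelˡ-coprime α β bézout k (∣ᶻ-pw-suc⇒∣ᶻ-pw k p^k+1∣na)))
    where
    a≡ : a ≡ α ℤ.* (n ℤ.* a) ℤ.+ β ℤ.* (+ p ℤ.* a)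
    a≡ = begin
      a                                       ≡⟨ ℤ.*-identityˡ a ⟨
      1ℤ ℤ.* a                                ≡⟨ cong (ℤ._* a) bézout ⟨
      (α ℤ.* n ℤ.+ β ℤ.* + p) ℤ.* a           ≡⟨ regroup α n β (+ p) a ⟩
      α ℤ.* (n ℤ.* a) ℤ.+ β ℤ.* (+ p ℤ.* a)   ∎
      where
      regroup : ∀ α n β p a → (α ℤ.* n ℤ.+ β ℤ.* p) ℤ.* a ≡ α ℤ.* (n ℤ.* a) ℤ.+ β ℤ.* (p ℤ.* a)
      regroup = solve-∀

  -- p^(k+1) ∣ p(x_{k+1} − y_{k+1}) gives p^k ∣ x_{k+1} − y_{k+1},
  -- and coherence of x and y brings this down to level k.
  ≈ᶻ-cancelˡ-p : .{{_ : NonZero p}} → ∀ {x y : ℤₚ p} → ιᶻ (+ p) *ᶻ x ≈ᶻ ιᶻ (+ p) *ᶻ y → x ≈ᶻ y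
  ≈ᶻ-cancelˡ-p {x} {y} px≈py k =
    ∣ᶻ-linear 1ℤ (ℤ.- 1ℤ) (telescope (seq x (suc k)) (seq y (suc k)) (seq x k) (seq y k))
      (∣ᶻ-cancelˡ-p k (subst (pw p (suc k) ∣ᶻ_)
        (*-distribˡ-difference (+ p) (seq x (suc k)) (seq y (suc k))) (px≈py (suc k))))
      (∣ᶻ-linear 1ℤ (ℤ.- 1ℤ) refl (coh x k) (coh y k))
    where
    telescope : ∀ x′ y′ x y → x ℤ.- y ≡ 1ℤ ℤ.* (x′ ℤ.- y′) ℤ.+ ℤ.- 1ℤ ℤ.* (1ℤ ℤ.* (x′ ℤ.- x) ℤ.+ ℤ.- 1ℤ ℤ.* (y′ ℤ.- y))
    telescope = solve-∀

  ≈ᶻ-cancelˡ-pw : .{{_ : NonZero p}} → ∀ f {x y : ℤₚ p} → ιᶻ (pw p f) *ᶻ x ≈ᶻ ιᶻ (pw p f) *ᶻ y → x ≈ᶻ y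
  ≈ᶻ-cancelˡ-pw zero {x} {y} h k =
    subst (pw p k ∣ᶻ_) (cong₂ ℤ._-_ (ℤ.*-identityˡ (seq x k)) (ℤ.*-identityˡ (seq y k))) (h k)
  ≈ᶻ-cancelˡ-pw (suc f) {x} {y} h = ≈ᶻ-cancelˡ-pw f {x} {y}
    (≈ᶻ-cancelˡ-p {ιᶻ (pw p f) *ᶻ x} {ιᶻ (pw p f) *ᶻ y} λ k →
    subst (pw p k ∣ᶻ_) (cong₂ ℤ._-_ (reassociate (seq x k)) (reassociate (seq y k))) (h k))
    where
    reassociate : ∀ a → pw p (suc f) ℤ.* a ≡ + p ℤ.* (pw p f ℤ.* a)
    reassociate a = trans (cong (ℤ._* a) (pw-suc p f)) (ℤ.*-assoc (+ p) (pw p f) a)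

  ≈ᶻ-cancelˡ-coprime : ∀ {n} α β → α ℤ.* n ℤ.+ β ℤ.* + p ≡ 1ℤ →
                       ∀ {x y : ℤₚ p} → ιᶻ n *ᶻ x ≈ᶻ ιᶻ n *ᶻ y → x ≈ᶻ y
  ≈ᶻ-cancelˡ-coprime {n} α β bézout {x} {y} nx≈ny k =
    ∣ᶻ-cancelˡ-coprime α β bézout k (subst (pw p k ∣ᶻ_) (*-distribˡ-difference n (seq x k) (seq y k)) (nx≈ny k))

-- ℚₚ as a commutative ring

module _ {p : ℕ} where

  ≈-refl : ∀ (x : ℚₚ p) → x ≈ x
  ≈-refl (x /p^ e) = λ k → ≡⇒∣ᶻ-difference {a = seq x k ℤ.* pw p e} refl

  ≈-sym : ∀ {x y : ℚₚ p} → x ≈ y → y ≈ x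
  ≈-sym {x /p^ e} {y /p^ f} x≈y k = ∣ᶻ-multiple (ℤ.- 1ℤ) (swap (seq x k ℤ.* pw p f) (seq y k ℤ.* pw p e)) (x≈y k)
    where
    swap : ∀ a b → b ℤ.- a ≡ ℤ.- 1ℤ ℤ.* (a ℤ.- b)
    swap = solve-∀

  ≈-trans : .{{_ : NonZero p}} → ∀ {x y z : ℚₚ p} → x ≈ y → y ≈ z → x ≈ z
  ≈-trans {x /p^ e} {y /p^ f} {z /p^ g} x≈y y≈z =
    ≈ᶻ-cancelˡ-pw f {x *ᶻ ιᶻ (pw p g)} {z *ᶻ ιᶻ (pw p e)} λ k →
      ∣ᶻ-linear (pw p g) (pw p e)
        (eliminate-y (seq x k) (seq y k) (seq z k) (pw p e) (pw p f) (pw p g)) (x≈y k) (y≈z k)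
    where
    eliminate-y : ∀ X Y Z E F G →
      F ℤ.* (X ℤ.* G) ℤ.- F ℤ.* (Z ℤ.* E) ≡ G ℤ.* (X ℤ.* F ℤ.- Y ℤ.* E) ℤ.+ E ℤ.* (Y ℤ.* G ℤ.- Z ℤ.* F)
    eliminate-y = solve-∀

  +-cong : ∀ {x x′ y y′ : ℚₚ p} → x ≈ x′ → y ≈ y′ → x + y ≈ x′ + y′
  +-cong {x /p^ e} {x′ /p^ e′} {y /p^ f} {y′ /p^ f′} x≈x′ y≈y′ k =
    ∣ᶻ-linear (F ℤ.* F′) (E ℤ.* E′)
      (trans (cong₂ (λ s t → (X ℤ.* F ℤ.+ Y ℤ.* E) ℤ.* s ℤ.- (X′ ℤ.* F′ ℤ.+ Y′ ℤ.* E′) ℤ.* t)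
                    (pw-+ p e′ f′) (pw-+ p e f))
             (identity X X′ Y Y′ E E′ F F′))
      (x≈x′ k) (y≈y′ k)
    where
    X = seq x k; X′ = seq x′ k; Y = seq y k; Y′ = seq y′ k
    E = pw p e; E′ = pw p e′; F = pw p f; F′ = pw p f′
    identity : ∀ X X′ Y Y′ E E′ F F′ →
      (X ℤ.* F ℤ.+ Y ℤ.* E) ℤ.* (E′ ℤ.* F′) ℤ.- (X′ ℤ.* F′ ℤ.+ Y′ ℤ.* E′) ℤ.* (E ℤ.* F)
        ≡ F ℤ.* F′ ℤ.* (X ℤ.* E′ ℤ.- X′ ℤ.* E) ℤ.+ E ℤ.* E′ ℤ.* (Y ℤ.* F′ ℤ.- Y′ ℤ.* F)
    identity = solve-∀

  *-cong : ∀ {x x′ y y′ : ℚₚ p} → x ≈ x′ → y ≈ y′ → x * y ≈ x′ * y′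
  *-cong {x /p^ e} {x′ /p^ e′} {y /p^ f} {y′ /p^ f′} x≈x′ y≈y′ k =
    ∣ᶻ-linear (Y ℤ.* F′) (X′ ℤ.* E)
      (trans (cong₂ (λ s t → X ℤ.* Y ℤ.* s ℤ.- X′ ℤ.* Y′ ℤ.* t) (pw-+ p e′ f′) (pw-+ p e f))
             (identity X X′ Y Y′ E E′ F F′))
      (x≈x′ k) (y≈y′ k)
    where
    X = seq x k; X′ = seq x′ k; Y = seq y k; Y′ = seq y′ k
    E = pw p e; E′ = pw p e′; F = pw p f; F′ = pw p f′
    identity : ∀ X X′ Y Y′ E E′ F F′ →
      X ℤ.* Y ℤ.* (E′ ℤ.* F′) ℤ.- X′ ℤ.* Y′ ℤ.* (E ℤ.* F)
        ≡ Y ℤ.* F′ ℤ.* (X ℤ.* E′ ℤ.- X′ ℤ.* E) ℤ.+ X′ ℤ.* E ℤ.* (Y ℤ.* F′ ℤ.- Y′ ℤ.* F)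
    identity = solve-∀

  +-comm : ∀ (x y : ℚₚ p) → x + y ≈ y + x
  +-comm (x /p^ e) (y /p^ f) = λ k → ≡⇒∣ᶻ-difference $
    cong₂ ℤ._*_ (ℤ.+-comm (seq x k ℤ.* pw p f) (seq y k ℤ.* pw p e)) (cong (pw p) (ℕ.+-comm f e))

  +-assoc : ∀ (x y z : ℚₚ p) → (x + y) + z ≈ x + (y + z)
  +-assoc (x /p^ e) (y /p^ f) (z /p^ g) = λ k → ≡⇒∣ᶻ-difference $
    cong₂ ℤ._*_ (numerators (seq x k) (seq y k) (seq z k)) (cong (pw p) (sym (ℕ.+-assoc e f g)))
    where
    E = pw p e; F = pw p f; G = pw p g
    identity : ∀ X Y Z E F G →
      (X ℤ.* F ℤ.+ Y ℤ.* E) ℤ.* G ℤ.+ Z ℤ.* (E ℤ.* F) ≡ X ℤ.* (F ℤ.* G) ℤ.+ (Y ℤ.* G ℤ.+ Z ℤ.* F) ℤ.* E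
    identity = solve-∀
    numerators : ∀ X Y Z →
      (X ℤ.* F ℤ.+ Y ℤ.* E) ℤ.* G ℤ.+ Z ℤ.* pw p (e ℕ.+ f) ≡ X ℤ.* pw p (f ℕ.+ g) ℤ.+ (Y ℤ.* G ℤ.+ Z ℤ.* F) ℤ.* E
    numerators X Y Z = begin
      (X ℤ.* F ℤ.+ Y ℤ.* E) ℤ.* G ℤ.+ Z ℤ.* pw p (e ℕ.+ f)     ≡⟨ cong (λ s → (X ℤ.* F ℤ.+ Y ℤ.* E) ℤ.* G ℤ.+ Z ℤ.* s) (pw-+ p e f) ⟩
      (X ℤ.* F ℤ.+ Y ℤ.* E) ℤ.* G ℤ.+ Z ℤ.* (E ℤ.* F)           ≡⟨ identity X Y Z E F G ⟩
      X ℤ.* (F ℤ.* G) ℤ.+ (Y ℤ.* G ℤ.+ Z ℤ.* F) ℤ.* E           ≡⟨ cong (λ s → X ℤ.* s ℤ.+ (Y ℤ.* G ℤ.+ Z ℤ.* F) ℤ.* E) (pw-+ p f g) ⟨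
      X ℤ.* pw p (f ℕ.+ g) ℤ.+ (Y ℤ.* G ℤ.+ Z ℤ.* F) ℤ.* E     ∎

  +-identityˡ : ∀ (x : ℚₚ p) → ι 0ℤ + x ≈ x
  +-identityˡ (x /p^ e) = λ k → ≡⇒∣ᶻ-difference $
    cong (ℤ._* pw p e) (trans (ℤ.+-identityˡ (seq x k ℤ.* 1ℤ)) (ℤ.*-identityʳ (seq x k)))

  *-comm : ∀ (x y : ℚₚ p) → x * y ≈ y * x
  *-comm (x /p^ e) (y /p^ f) = λ k → ≡⇒∣ᶻ-difference $
    cong₂ ℤ._*_ (ℤ.*-comm (seq x k) (seq y k)) (cong (pw p) (ℕ.+-comm f e))

  *-assoc : ∀ (x y z : ℚₚ p) → (x * y) * z ≈ x * (y * z)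
  *-assoc (x /p^ e) (y /p^ f) (z /p^ g) = λ k → ≡⇒∣ᶻ-difference $
    cong₂ ℤ._*_ (ℤ.*-assoc (seq x k) (seq y k) (seq z k)) (cong (pw p) (sym (ℕ.+-assoc e f g)))

  *-identityˡ : ∀ (x : ℚₚ p) → ι 1ℤ * x ≈ x
  *-identityˡ (x /p^ e) = λ k → ≡⇒∣ᶻ-difference $ cong (ℤ._* pw p e) (ℤ.*-identityˡ (seq x k))

  *-zeroˡ : ∀ (x : ℚₚ p) → ι 0ℤ * x ≈ ι 0ℤ
  *-zeroˡ (x /p^ e) = λ k → ≡⇒∣ᶻ-difference {a = 0ℤ} refl

  *-distribʳ-+ : ∀ (x y z : ℚₚ p) → (y + z) * x ≈ y * x + z * x
  *-distribʳ-+ (x /p^ e) (y /p^ f) (z /p^ g) = λ k → ≡⇒∣ᶻ-difference $ begin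
    numerator k ℤ.* pw p ((f ℕ.+ e) ℕ.+ (g ℕ.+ e))     ≡⟨ cong (λ s → numerator k ℤ.* pw p s) (exponents f g e) ⟩
    numerator k ℤ.* pw p (((f ℕ.+ g) ℕ.+ e) ℕ.+ e)     ≡⟨ cong (numerator k ℤ.*_) (pw-+ p ((f ℕ.+ g) ℕ.+ e) e) ⟩
    numerator k ℤ.* (pw p ((f ℕ.+ g) ℕ.+ e) ℤ.* E)     ≡⟨ ℤ.*-assoc (numerator k) _ E ⟨
    numerator k ℤ.* pw p ((f ℕ.+ g) ℕ.+ e) ℤ.* E       ≡⟨ *-right-comm (numerator k) _ E ⟩
    numerator k ℤ.* E ℤ.* pw p ((f ℕ.+ g) ℕ.+ e)       ≡⟨ cong (ℤ._* pw p ((f ℕ.+ g) ℕ.+ e)) (distributed k) ⟩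
    (seq y k ℤ.* seq x k ℤ.* pw p (g ℕ.+ e) ℤ.+ seq z k ℤ.* seq x k ℤ.* pw p (f ℕ.+ e))
      ℤ.* pw p ((f ℕ.+ g) ℕ.+ e)                       ∎
    where
    E = pw p e; F = pw p f; G = pw p g
    numerator : ℕ → ℤ
    numerator k = (seq y k ℤ.* G ℤ.+ seq z k ℤ.* F) ℤ.* seq x k
    exponents : ∀ f g e → (f ℕ.+ e) ℕ.+ (g ℕ.+ e) ≡ ((f ℕ.+ g) ℕ.+ e) ℕ.+ e
    exponents = ℕ-solve-∀
    *-right-comm : ∀ a b c → a ℤ.* b ℤ.* c ≡ a ℤ.* c ℤ.* b
    *-right-comm = solve-∀
    identity : ∀ X Y Z E F G →
      (Y ℤ.* G ℤ.+ Z ℤ.* F) ℤ.* X ℤ.* E ≡ Y ℤ.* X ℤ.* (G ℤ.* E) ℤ.+ Z ℤ.* X ℤ.* (F ℤ.* E)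
    identity = solve-∀
    distributed : ∀ k → numerator k ℤ.* E
      ≡ seq y k ℤ.* seq x k ℤ.* pw p (g ℕ.+ e) ℤ.+ seq z k ℤ.* seq x k ℤ.* pw p (f ℕ.+ e)
    distributed k = trans (identity (seq x k) (seq y k) (seq z k) E F G)
      (sym (cong₂ (λ s t → seq y k ℤ.* seq x k ℤ.* s ℤ.+ seq z k ℤ.* seq x k ℤ.* t) (pw-+ p g e) (pw-+ p f e)))

  -ₚ‿+-comm : ∀ (x y : ℚₚ p) → -ₚ x + -ₚ y ≈ -ₚ (x + y)
  -ₚ‿+-comm (x /p^ e) (y /p^ f) = λ k → ≡⇒∣ᶻ-difference $
    cong (ℤ._* pw p (e ℕ.+ f)) (identity (seq x k) (seq y k) (pw p e) (pw p f))
    where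
    identity : ∀ X Y E F → ℤ.- 1ℤ ℤ.* X ℤ.* F ℤ.+ ℤ.- 1ℤ ℤ.* Y ℤ.* E ≡ ℤ.- 1ℤ ℤ.* (X ℤ.* F ℤ.+ Y ℤ.* E)
    identity = solve-∀

  ι-+ : ∀ m n → ι {p} (m ℤ.+ n) ≈ ι m + ι n
  ι-+ m n = λ k → ≡⇒∣ᶻ-difference $ cong (ℤ._* 1ℤ) (sym (cong₂ ℤ._+_ (ℤ.*-identityʳ m) (ℤ.*-identityʳ n)))

  ι-* : ∀ m n → ι {p} (m ℤ.* n) ≈ ι m * ι n
  ι-* m n = λ k → ≡⇒∣ᶻ-difference {a = m ℤ.* n ℤ.* 1ℤ} refl

  ι-neg : ∀ m → ι {p} (ℤ.- m) ≈ -ₚ ι m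
  ι-neg m = λ k → ≡⇒∣ᶻ-difference $ cong (ℤ._* 1ℤ) (sym (ℤ.-1*i≡-i m))

module _ (p : ℕ) .{{_ : NonZero p}} where

  private
    module CommutativeMonoidˡ (_∙_ : ℚₚ p → ℚₚ p → ℚₚ p) (ε : ℚₚ p)
      (∙-cong : ∀ {x x′ y y′} → x ≈ x′ → y ≈ y′ → x ∙ y ≈ x′ ∙ y′)
      (assoc : ∀ x y z → (x ∙ y) ∙ z ≈ x ∙ (y ∙ z))
      (identityˡ : ∀ x → ε ∙ x ≈ x)
      (comm : ∀ x y → x ∙ y ≈ y ∙ x) where
      isCommutativeMonoid : IsCommutativeMonoid _≈_ _∙_ ε
      isCommutativeMonoid = isCommutativeMonoidˡ record
        { isSemigroup = record
          { isMagma = record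
            { isEquivalence = record
              { refl = λ {x} → ≈-refl x
              ; sym = λ {x} {y} → ≈-sym {x = x} {y}
              ; trans = λ {x} {y} {z} → ≈-trans {x = x} {y} {z}
              }
            ; ∙-cong = λ {x} {x′} {y} {y′} → ∙-cong {x} {x′} {y} {y′}
            }
          ; assoc = assoc
          }
        ; identityˡ = identityˡ
        ; comm = comm
        }

  -- The operations are literally those of Defs, so that the forms of
  -- CubicChangeOfVariables unfold to the ones in the theorem.
  ℚₚ-ring : AlmostCommutativeRing 0ℓ 0ℓ
  ℚₚ-ring = record
    { Carrier = ℚₚ p
    ; _≈_ = _≈_
    ; _+_ = _+_
    ; _*_ = _*_
    ; -_ = -ₚ_
    ; 0# = ι 0ℤ
    ; 1# = ι 1ℤ
    ; isAlmostCommutativeRing = record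
      { isCommutativeSemiring = IsCommutativeSemiringˡ.isCommutativeSemiring record
        { +-isCommutativeMonoid = CommutativeMonoidˡ.isCommutativeMonoid _+_ (ι 0ℤ)
            (λ {x} {x′} {y} {y′} → +-cong {x = x} {x′} {y} {y′}) +-assoc +-identityˡ +-comm
        ; *-isCommutativeMonoid = CommutativeMonoidˡ.isCommutativeMonoid _*_ (ι 1ℤ)
            (λ {x} {x′} {y} {y′} → *-cong {x = x} {x′} {y} {y′}) *-assoc *-identityˡ *-comm
        ; distribʳ = *-distribʳ-+
        ; zeroˡ = *-zeroˡ
        }
      ; -‿cong = λ {x} {y} → *-cong {x = ι (ℤ.- 1ℤ)} {ι (ℤ.- 1ℤ)} {x} {y} (≈-refl (ι (ℤ.- 1ℤ)))
      ; -‿*-distribˡ = λ x y → *-assoc (ι (ℤ.- 1ℤ)) x y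
      ; -‿+-comm = -ₚ‿+-comm
      }
    }

  ι-homomorphism : ℤ.+-*-rawRing -Raw-AlmostCommutative⟶ ℚₚ-ring
  ι-homomorphism = record
    { ⟦_⟧ = ι
    ; +-homo = ι-+
    ; *-homo = ι-*
    ; -‿homo = ι-neg
    ; 0-homo = ≈-refl (ι 0ℤ)
    ; 1-homo = ≈-refl (ι 1ℤ)
    }

module _ {p : ℕ} .{{_ : NonZero p}} where

  open CubicChangeOfVariables (ℚₚ-ring p) (ι-homomorphism p) using (NonZeroDivisor)

  ι-nonZeroDivisor : ∀ n → (∀ {x y : ℤₚ p} → ιᶻ n *ᶻ x ≈ᶻ ιᶻ n *ᶻ y → x ≈ᶻ y) → NonZeroDivisor (ι n)
  ι-nonZeroDivisor n cancel (x /p^ e) nx≈0 k =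
    subst (pw p k ∣ᶻ_) (x≈0 (seq x k) (pw p e))
      (cancel {x} {ιᶻ 0ℤ} (λ j → subst (pw p j ∣ᶻ_) (nx≈0-form n (seq x j) (pw p e)) (nx≈0 j)) k)
    where
    nx≈0-form : ∀ n X E → n ℤ.* X ℤ.* 1ℤ ℤ.- 0ℤ ℤ.* E ≡ n ℤ.* X ℤ.- n ℤ.* 0ℤ
    nx≈0-form = solve-∀
    x≈0 : ∀ X E → X ℤ.- 0ℤ ≡ X ℤ.* 1ℤ ℤ.- 0ℤ ℤ.* E
    x≈0 = solve-∀

  coprime-nonZeroDivisor : ∀ n → Coprime p ℤ.∣ n ∣ → NonZeroDivisor (ι n)
  coprime-nonZeroDivisor n coprime with coprime⇒bézout {p} {n} coprime
  ... | α , β , bézout = ι-nonZeroDivisor n (λ {x} {y} → ≈ᶻ-cancelˡ-coprime α β bézout {x} {y})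

  2-nonZeroDivisor : Prime p → NonZeroDivisor (ι (+ 2))
  2-nonZeroDivisor p-prime with p ℕ.≟ 2
  ... | yes refl = ι-nonZeroDivisor (+ 2) (λ {x} {y} → ≈ᶻ-cancelˡ-p {x = x} {y})
  ... | no p≢2 = coprime-nonZeroDivisor (+ 2) (prime⇒coprime p-prime 2<p)
    where
    2<p : 2 ℕ.< p
    2<p = ℕ.≤∧≢⇒< (ℕ.nonTrivial⇒n>1 p {{prime⇒nonTrivial p-prime}}) (λ 2≡p → p≢2 (sym 2≡p))

-- Square roots in ℚₚ

newton-square : ∀ D u w q r p P →
  w ℤ.* w ≡ D ℤ.+ + 4 ℤ.* q ℤ.* (p ℤ.* P) → u ℤ.* w ≡ 1ℤ ℤ.+ r ℤ.* p →
  (w ℤ.- + 2 ℤ.* u ℤ.* q ℤ.* (p ℤ.* P)) ℤ.* (w ℤ.- + 2 ℤ.* u ℤ.* q ℤ.* (p ℤ.* P))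
    ≡ D ℤ.+ + 4 ℤ.* (u ℤ.* u ℤ.* q ℤ.* q ℤ.* P ℤ.- q ℤ.* r) ℤ.* (p ℤ.* (p ℤ.* P))
newton-square D u w q r p P w²≡ uw≡ = begin
  (w ℤ.- + 2 ℤ.* u ℤ.* q ℤ.* (p ℤ.* P)) ℤ.* (w ℤ.- + 2 ℤ.* u ℤ.* q ℤ.* (p ℤ.* P))
    ≡⟨ ℤ-solve (w ∷ u ∷ q ∷ p ∷ P ∷ []) ⟩
  w ℤ.* w ℤ.- + 4 ℤ.* q ℤ.* (p ℤ.* P) ℤ.* (u ℤ.* w) ℤ.+ + 4 ℤ.* (u ℤ.* u ℤ.* q ℤ.* q) ℤ.* (p ℤ.* P) ℤ.* (p ℤ.* P)
    ≡⟨ cong₂ (λ s t → s ℤ.- + 4 ℤ.* q ℤ.* (p ℤ.* P) ℤ.* t ℤ.+ + 4 ℤ.* (u ℤ.* u ℤ.* q ℤ.* q) ℤ.* (p ℤ.* P) ℤ.* (p ℤ.* P)) w²≡ uw≡ ⟩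
  D ℤ.+ + 4 ℤ.* q ℤ.* (p ℤ.* P) ℤ.- + 4 ℤ.* q ℤ.* (p ℤ.* P) ℤ.* (1ℤ ℤ.+ r ℤ.* p) ℤ.+ + 4 ℤ.* (u ℤ.* u ℤ.* q ℤ.* q) ℤ.* (p ℤ.* P) ℤ.* (p ℤ.* P)
    ≡⟨ ℤ-solve (D ∷ u ∷ q ∷ r ∷ p ∷ P ∷ []) ⟩
  D ℤ.+ + 4 ℤ.* (u ℤ.* u ℤ.* q ℤ.* q ℤ.* P ℤ.- q ℤ.* r) ℤ.* (p ℤ.* (p ℤ.* P)) ∎

newton-unit : ∀ u w r q p P → u ℤ.* w ≡ 1ℤ ℤ.+ r ℤ.* p →
  u ℤ.* (w ℤ.- + 2 ℤ.* u ℤ.* q ℤ.* (p ℤ.* P)) ≡ 1ℤ ℤ.+ (r ℤ.- + 2 ℤ.* u ℤ.* u ℤ.* q ℤ.* P) ℤ.* p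
newton-unit u w r q p P uw≡ = begin
  u ℤ.* (w ℤ.- + 2 ℤ.* u ℤ.* q ℤ.* (p ℤ.* P))          ≡⟨ ℤ-solve (u ∷ w ∷ q ∷ p ∷ P ∷ []) ⟩
  u ℤ.* w ℤ.- + 2 ℤ.* u ℤ.* u ℤ.* q ℤ.* P ℤ.* p         ≡⟨ cong (ℤ._- + 2 ℤ.* u ℤ.* u ℤ.* q ℤ.* P ℤ.* p) uw≡ ⟩
  1ℤ ℤ.+ r ℤ.* p ℤ.- + 2 ℤ.* u ℤ.* u ℤ.* q ℤ.* P ℤ.* p  ≡⟨ ℤ-solve (u ∷ r ∷ q ∷ p ∷ P ∷ []) ⟩
  1ℤ ℤ.+ (r ℤ.- + 2 ℤ.* u ℤ.* u ℤ.* q ℤ.* P) ℤ.* p     ∎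

module SquareRoot (p : ℕ) (D u : ℤ) where

  -- w² ≡ D modulo 4p^(m+1), and u inverts w modulo p. Newton's correction (w² − D)/2w
  -- divides by 2; the factor 4 in the modulus keeps it integral, so p = 2 is no exception.
  record Approximation (m : ℕ) : Set where
    constructor approximation
    field
      w q r : ℤ
      w²≡ : w ℤ.* w ≡ D ℤ.+ + 4 ℤ.* q ℤ.* pw p (suc m)
      uw≡ : u ℤ.* w ≡ 1ℤ ℤ.+ r ℤ.* + p

  open Approximation

  newton : ∀ {m} → Approximation m → Approximation (suc m)
  newton {m} (approximation w q r w²≡ uw≡) = approximation w′ q′ r′ w′²≡ uw′≡
    where
    P = pw p m
    w′ = w ℤ.- + 2 ℤ.* u ℤ.* q ℤ.* (+ p ℤ.* P)
    q′ = u ℤ.* u ℤ.* q ℤ.* q ℤ.* P ℤ.- q ℤ.* r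
    r′ = r ℤ.- + 2 ℤ.* u ℤ.* u ℤ.* q ℤ.* P
    w′²≡ : w′ ℤ.* w′ ≡ D ℤ.+ + 4 ℤ.* q′ ℤ.* pw p (suc (suc m))
    w′²≡ = begin
      w′ ℤ.* w′                                    ≡⟨ newton-square D u w q r (+ p) P w²≡′ uw≡ ⟩
      D ℤ.+ + 4 ℤ.* q′ ℤ.* (+ p ℤ.* (+ p ℤ.* P))   ≡⟨ cong (λ s → D ℤ.+ + 4 ℤ.* q′ ℤ.* (+ p ℤ.* s)) (pw-suc p m) ⟨
      D ℤ.+ + 4 ℤ.* q′ ℤ.* (+ p ℤ.* pw p (suc m))  ≡⟨ cong (λ s → D ℤ.+ + 4 ℤ.* q′ ℤ.* s) (pw-suc p (suc m)) ⟨
      D ℤ.+ + 4 ℤ.* q′ ℤ.* pw p (suc (suc m))      ∎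
      where
      w²≡′ : w ℤ.* w ≡ D ℤ.+ + 4 ℤ.* q ℤ.* (+ p ℤ.* P)
      w²≡′ = trans w²≡ (cong (λ s → D ℤ.+ + 4 ℤ.* q ℤ.* s) (pw-suc p m))
    uw′≡ : u ℤ.* w′ ≡ 1ℤ ℤ.+ r′ ℤ.* + p
    uw′≡ = newton-unit u w r q (+ p) P uw≡

  newton-coherent : ∀ {m} (a : Approximation m) → pw p m ∣ᶻ (w (newton a) ℤ.- w a)
  newton-coherent {m} (approximation w q _ _ _) =
    ℤ.- (+ 2 ℤ.* u ℤ.* q ℤ.* + p) , correction w u q (+ p) (pw p m)
    where
    correction : ∀ w u q p P → w ℤ.- + 2 ℤ.* u ℤ.* q ℤ.* (p ℤ.* P) ℤ.- w ≡ ℤ.- (+ 2 ℤ.* u ℤ.* q ℤ.* p) ℤ.* P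
    correction = solve-∀

  approximation-square : ∀ {m} (a : Approximation m) → pw p m ∣ᶻ (w a ℤ.* w a ℤ.* 1ℤ ℤ.- D ℤ.* 1ℤ)
  approximation-square {m} (approximation w q _ w²≡ _) = + 4 ℤ.* q ℤ.* + p , (begin
    w ℤ.* w ℤ.* 1ℤ ℤ.- D ℤ.* 1ℤ
      ≡⟨ cong (λ s → s ℤ.* 1ℤ ℤ.- D ℤ.* 1ℤ) (trans w²≡ (cong (λ P → D ℤ.+ + 4 ℤ.* q ℤ.* P) (pw-suc p m))) ⟩
    (D ℤ.+ + 4 ℤ.* q ℤ.* (+ p ℤ.* pw p m)) ℤ.* 1ℤ ℤ.- D ℤ.* 1ℤ
      ≡⟨ error D q (+ p) (pw p m) ⟩
    + 4 ℤ.* q ℤ.* + p ℤ.* pw p m ∎)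
    where
    error : ∀ D q p P → (D ℤ.+ + 4 ℤ.* q ℤ.* (p ℤ.* P)) ℤ.* 1ℤ ℤ.- D ℤ.* 1ℤ ≡ + 4 ℤ.* q ℤ.* p ℤ.* P
    error = solve-∀

  module _ (a₀ : Approximation 0) where

    approximations : ∀ m → Approximation m
    approximations zero = a₀
    approximations (suc m) = newton (approximations m)

    sqrt : Σ (ℚₚ p) λ d → d * d ≈ ι D
    sqrt = mkℤₚ (λ m → w (approximations m)) (λ m → newton-coherent (approximations m)) /p^ 0
         , λ k → approximation-square (approximations k)

split⇒sqrt : ∀ {p D} → Prime p → SplitIn D p → Σ (ℚₚ p) λ d → d * d ≈ ι D
split⇒sqrt {p} {D} p-prime (p∤D , t , 4p∣t²-D) =
  SquareRoot.sqrt p D α (SquareRoot.approximation t c (ℤ.- β) t²≡ αt≡)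
  where
  open Signed._∣_ (Signed.∣ᵤ⇒∣ {+ (4 ℕ.* p)} {t ℤ.* t ℤ.- D} 4p∣t²-D) renaming (quotient to c; equality to t²-D≡)

  t²-D≡4cp : t ℤ.* t ℤ.- D ≡ c ℤ.* (+ 4 ℤ.* + p)
  t²-D≡4cp = trans t²-D≡ (cong (c ℤ.*_) (ℤ.pos-* 4 p))

  t²≡ : t ℤ.* t ≡ D ℤ.+ + 4 ℤ.* c ℤ.* pw p 1
  t²≡ = begin
    t ℤ.* t                         ≡⟨ ℤ-solve (D ∷ t ∷ []) ⟩
    D ℤ.+ (t ℤ.* t ℤ.- D)           ≡⟨ cong (ℤ._+_ D) t²-D≡4cp ⟩
    D ℤ.+ c ℤ.* (+ 4 ℤ.* + p)       ≡⟨ regroup D c (+ p) ⟩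
    D ℤ.+ + 4 ℤ.* c ℤ.* + p         ≡⟨ cong (λ P → D ℤ.+ + 4 ℤ.* c ℤ.* P) (cong +_ (ℕ.*-identityʳ p)) ⟨
    D ℤ.+ + 4 ℤ.* c ℤ.* pw p 1      ∎
    where
    regroup : ∀ D c p → D ℤ.+ c ℤ.* (+ 4 ℤ.* p) ≡ D ℤ.+ + 4 ℤ.* c ℤ.* p
    regroup = solve-∀

  p∤t : ¬ (+ p ∣ t)
  p∤t p∣t with Signed.∣ᵤ⇒∣ {+ p} {t} p∣t
  ... | Signed.divides a t≡ap = p∤D (Signed.∣⇒∣ᵤ (Signed.divides (a ℤ.* t ℤ.- + 4 ℤ.* c) (begin
    D                                          ≡⟨ ℤ-solve (D ∷ t ∷ []) ⟩
    t ℤ.* t ℤ.- (t ℤ.* t ℤ.- D)                ≡⟨ cong₂ (λ s r → s ℤ.* t ℤ.- r) t≡ap t²-D≡4cp ⟩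
    a ℤ.* + p ℤ.* t ℤ.- c ℤ.* (+ 4 ℤ.* + p)    ≡⟨ factor a t c (+ p) ⟩
    (a ℤ.* t ℤ.- + 4 ℤ.* c) ℤ.* + p            ∎)))
    where
    factor : ∀ a t c p → a ℤ.* p ℤ.* t ℤ.- c ℤ.* (+ 4 ℤ.* p) ≡ (a ℤ.* t ℤ.- + 4 ℤ.* c) ℤ.* p
    factor = solve-∀

  t-bézout : Σ ℤ λ α → Σ ℤ λ β → α ℤ.* t ℤ.+ β ℤ.* + p ≡ 1ℤ
  t-bézout = coprime⇒bézout {p} {t} (prime∤⇒coprime {p} {t} p-prime p∤t)

  α β : ℤ
  α = proj₁ t-bézout
  β = proj₁ (proj₂ t-bézout)

  αt≡ : α ℤ.* t ≡ 1ℤ ℤ.+ ℤ.- β ℤ.* + p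
  αt≡ = trans (move α t β (+ p)) (cong (λ s → s ℤ.+ ℤ.- β ℤ.* + p) (proj₂ (proj₂ t-bézout)))
    where
    move : ∀ a t b p → a ℤ.* t ≡ a ℤ.* t ℤ.+ b ℤ.* p ℤ.+ ℤ.- b ℤ.* p
    move = solve-∀

corollary6p3 :
    (a b D b₁ b₃ : ℤ) →
    FundamentalDiscriminant D → D ≢ 1ℤ →
    b > 0ℤ → (+ 4 *ℤ D) *ℤ (a ^ℤ 3) ≢ + 27 *ℤ b →
    b ≡ b₁ *ℤ (b₃ ^ℤ 3) → CubeFree b₁ → gcd a b₃ ≡ 1ℤ →
    -- v = v₁ + v₂√D with 2v₁ = x, 2v₂ = y
    (x y : ℤ) → InOK D x y → Primitive D x y →
    (∀ (q : ℕ) → Prime q → + q ∣ normK D x y → SplitIn D q) →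
    (p : ℕ) → Prime p → SplitIn D p →
    Σ (ℚₚ p) λ dₚ → (dₚ * dₚ ≈ ι D) ×
      (∀ (v₁ v₂ c₃ : ℚₚ p) →
        ι (+ 2) * v₁ ≈ ι x → ι (+ 2) * v₂ ≈ ι y →
        -- c₃ = 2b / (v τ(v))
        ι (normK D x y) * c₃ ≈ ι (+ 2 *ℤ b) →
        HasNontrivialZero p (λ X Y Z →
            ι (+ 2) * v₂ * X ³ + ι (+ 2) * ι D * v₁ * Y ³ + c₃ * Z ³
            + ι (+ 6) * v₁ * X ² * Y + ι (+ 6) * v₂ * ι D * X * Y ²
            + ι (+ 2) * ι a * (X ² * Z -ₚ ι D * Y ² * Z))
        ⇔
        HasNontrivialZero p (λ X Y Z →
            (v₁ + v₂ * dₚ) * X ³ + (v₁ -ₚ v₂ * dₚ) * Y ³ + (c₃ * dₚ) * Z ³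
            -ₚ ι (+ 2) * ι a * dₚ * X * Y * Z))
corollary6p3 a _ D _ _ _ _ _ _ _ _ _ _ _ _ _ _ p p-prime p-split@(p∤D , _) =
  d , d²≈D , λ v₁ v₂ c₃ _ _ _ →
    cubicForm⇔hesseForm (ι a) (ι D) d d²≈D
      (2-nonZeroDivisor p-prime) (coprime-nonZeroDivisor D (prime∤⇒coprime {p} {D} p-prime p∤D)) v₁ v₂ c₃
  where
  instance
    p≢0 : NonZero p
    p≢0 = prime⇒nonZero p-prime
  open CubicChangeOfVariables (ℚₚ-ring p) (ι-homomorphism p) using (cubicForm⇔hesseForm)
  d : ℚₚ p
  d = proj₁ (split⇒sqrt p-prime p-split)
  d²≈D : d * d ≈ ι D
  d²≈D = proj₂ (split⇒sqrt p-prime p-split)
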